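{- Let $k$ be a positive integer and let $G$ be a finite simple graph with $\rho_k(G)=\rho_{2k}(G)$. Then $G$ is $k$-equipackable.
   Context: A $k$-packing in $G$ is a set of vertices whose pairwise distances are larger than $k$; $\rho_k(G)$ is the maximum size of a $k$-packing. A graph is $k$-equipackable if all its maximal (by inclusion) $k$-packings have the same size. -}

module Defs where

open import Data.Nat using (ℕ; zero; suc; _≤_; _*_)
open import Data.Fin using (Fin)
open import Data.Fin.Subset using (Subset; _∈_; _∉_; ∣_∣; _∪_; ⁅_⁆)
open import Data.Product using (Σ; ∃; _×_; _,_)
open import Relation.Nullary using (¬_)
open import Relation.Binary using (Decidable)
open import Relation.Binary.PropositionalEquality using (_≡_; _≢_)

record Graph (n : ℕ) : Set₁ where
  field
    Adj    : Fin n → Fin n → Set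
    adj?   : Decidable Adj
    sym    : ∀ {u v} → Adj u v → Adj v u
    irrefl : ∀ {u} → ¬ Adj u u

open Graph public

data Walk {n : ℕ} (G : Graph n) : Fin n → Fin n → ℕ → Set where
  here : ∀ {u} → Walk G u u zero
  step : ∀ {u v w ℓ} → Adj G u v → Walk G v w ℓ → Walk G u w (suc ℓ)

DistLE : ∀ {n} → Graph n → Fin n → Fin n → ℕ → Set
DistLE G u v k = ∃ λ ℓ → ℓ ≤ k × Walk G u v ℓ

IsPacking : ∀ {n} → ℕ → Graph n → Subset n → Set
IsPacking k G S = ∀ {u v} → u ∈ S → v ∈ S → u ≢ v → ¬ DistLE G u v k

IsMaximalPacking : ∀ {n} → ℕ → Graph n → Subset n → Set
IsMaximalPacking k G S =
  IsPacking k G S × (∀ v → v ∉ S → ¬ IsPacking k G (⁅ v ⁆ ∪ S))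

PackingNumber : ∀ {n} → ℕ → Graph n → ℕ → Set
PackingNumber k G m =
  (∃ λ S → IsPacking k G S × ∣ S ∣ ≡ m) × (∀ T → IsPacking k G T → ∣ T ∣ ≤ m)

Equipackable : ∀ {n} → ℕ → Graph n → Set
Equipackable k G =
  ∀ S T → IsMaximalPacking k G S → IsMaximalPacking k G T → ∣ S ∣ ≡ ∣ T ∣

-- A maximal k-packing S is k-dominating: a vertex at distance > k from all of S
-- could be added to it.  Sending each vertex of a 2k-packing P to a vertex of S
-- within distance k is then injective, since two vertices of P sharing an image
-- would be within distance 2k of each other.  Hence ρ_{2k} ≤ ∣ S ∣ ≤ ρ_k, and when
-- the two numbers agree every maximal k-packing has size ρ_k.
module Submission where

open import Defs
open import Data.Nat using (ℕ; zero; suc; _+_; _*_; _≤_; z≤n; s≤s; s≤s⁻¹; anyUpTo?)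
open import Data.Nat.Properties using (≤-trans; ≤-antisym; +-identityʳ; +-mono-≤)
open import Data.Fin using (Fin; zero; suc; _≟_)
open import Data.Fin.Properties using (any?; suc-injective; 0≢1+n)
open import Data.Fin.Subset using (Subset; inside; outside; _∈_; _∉_; ∣_∣; _∪_; ⁅_⁆; _-_)
open import Data.Fin.Subset.Properties
  using (_∈?_; x∈p∪q⁻; x∈⁅y⁆⇒x≡y; x∈p∧x≢y⇒x∈p-y; x∈p⇒∣p-x∣<∣p∣)
open import Data.Vec.Base using ([]; _∷_; here; there)
open import Data.Product using (∃; _×_; _,_; proj₁; proj₂)
open import Data.Sum using (inj₁; inj₂)
open import Data.Empty using (⊥-elim)
open import Relation.Nullary using (Dec; yes; no; ¬_)
open import Relation.Nullary.Decidable using (map′; _×-dec_; decidable-stable)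
open import Relation.Binary.PropositionalEquality
  using (_≡_; refl; cong; subst; trans) renaming (sym to ≡-sym)

injection⇒∣p∣≤∣q∣ : ∀ {m n} {p : Subset m} {q : Subset n} (f : Fin m → Fin n) →
  (∀ {x} → x ∈ p → f x ∈ q) →
  (∀ {x y} → x ∈ p → y ∈ p → f x ≡ f y → x ≡ y) →
  ∣ p ∣ ≤ ∣ q ∣
injection⇒∣p∣≤∣q∣ {p = []} _ _ _ = z≤n
injection⇒∣p∣≤∣q∣ {p = outside ∷ p} f into inj =
  injection⇒∣p∣≤∣q∣ (λ x → f (suc x)) (λ x∈p → into (there x∈p))
    (λ x∈p y∈p eq → suc-injective (inj (there x∈p) (there y∈p) eq))
injection⇒∣p∣≤∣q∣ {p = inside ∷ p} {q} f into inj =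
  ≤-trans (s≤s ∣p∣≤∣q-f0∣) (x∈p⇒∣p-x∣<∣p∣ (into here))
  where
  ∣p∣≤∣q-f0∣ : ∣ p ∣ ≤ ∣ q - f zero ∣
  ∣p∣≤∣q-f0∣ = injection⇒∣p∣≤∣q∣ (λ x → f (suc x))
    (λ x∈p → x∈p∧x≢y⇒x∈p-y (into (there x∈p)) (λ eq → 0≢1+n (≡-sym (inj (there x∈p) here eq))))
    (λ x∈p y∈p eq → suc-injective (inj (there x∈p) (there y∈p) eq))

module _ {n : ℕ} (G : Graph n) where

  _++ʷ_ : ∀ {u v w a b} → Walk G u v a → Walk G v w b → Walk G u w (a + b)
  here     ++ʷ q = q
  step e p ++ʷ q = step e (p ++ʷ q)

  _∷ʳʷ_ : ∀ {u v w a} → Walk G u v a → Adj G v w → Walk G u w (suc a)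
  here     ∷ʳʷ e = step e here
  step d p ∷ʳʷ e = step d (p ∷ʳʷ e)

  reverseʷ : ∀ {u v a} → Walk G u v a → Walk G v u a
  reverseʷ here       = here
  reverseʷ (step e p) = reverseʷ p ∷ʳʷ sym G e

  Walk? : ∀ ℓ u v → Dec (Walk G u v ℓ)
  Walk? zero u v = map′ (λ { refl → here }) (λ { here → refl }) (u ≟ v)
  Walk? (suc ℓ) u w =
    map′ (λ (v , e , p) → step e p) (λ { (step e p) → _ , e , p })
         (any? λ v → adj? G u v ×-dec Walk? ℓ v w)

  DistLE? : ∀ k u v → Dec (DistLE G u v k)
  DistLE? k u v =
    map′ (λ (ℓ , ℓ<1+k , p) → ℓ , s≤s⁻¹ ℓ<1+k , p) (λ (ℓ , ℓ≤k , p) → ℓ , s≤s ℓ≤k , p)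
         (anyUpTo? (λ ℓ → Walk? ℓ u v) (suc k))

  DistLE-sym : ∀ {u v k} → DistLE G u v k → DistLE G v u k
  DistLE-sym (ℓ , ℓ≤k , p) = ℓ , ℓ≤k , reverseʷ p

  DistLE-trans : ∀ {u v w a b} → DistLE G u v a → DistLE G v w b → DistLE G u w (a + b)
  DistLE-trans (ℓ , ℓ≤a , p) (ℓ′ , ℓ′≤b , q) = ℓ + ℓ′ , +-mono-≤ ℓ≤a ℓ′≤b , p ++ʷ q

  Dominating : ℕ → Subset n → Set
  Dominating k S = ∀ v → ∃ λ s → s ∈ S × DistLE G v s k

  packing-∪-far : ∀ {k S v} → IsPacking k G S →
    (∀ {s} → s ∈ S → ¬ DistLE G v s k) → IsPacking k G (⁅ v ⁆ ∪ S)
  packing-∪-far {S = S} {v} pack far {x} {y} x∈ y∈ x≢y d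
    with x∈p∪q⁻ ⁅ v ⁆ S x∈ | x∈p∪q⁻ ⁅ v ⁆ S y∈
  ... | inj₁ x≡v | inj₁ y≡v = x≢y (trans (x∈⁅y⁆⇒x≡y v x≡v) (≡-sym (x∈⁅y⁆⇒x≡y v y≡v)))
  ... | inj₁ x≡v | inj₂ y∈S rewrite x∈⁅y⁆⇒x≡y v x≡v = far y∈S d
  ... | inj₂ x∈S | inj₁ y≡v rewrite x∈⁅y⁆⇒x≡y v y≡v = far x∈S (DistLE-sym d)
  ... | inj₂ x∈S | inj₂ y∈S = pack x∈S y∈S x≢y d

  maximal-packing⇒dominating : ∀ {k S} → IsMaximalPacking k G S → Dominating k S
  maximal-packing⇒dominating {k} {S} (pack , maximal) v =
    decidable-stable (any? λ s → (s ∈? S) ×-dec DistLE? k v s) ¬¬near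
    where
    ¬¬near : ¬ ¬ (∃ λ s → s ∈ S × DistLE G v s k)
    ¬¬near ¬near = maximal v v∉S (packing-∪-far pack (λ s∈S d → ¬near (_ , s∈S , d)))
      where
      v∉S : v ∉ S
      v∉S v∈S = ¬near (v , v∈S , 0 , z≤n , here)

  ∣2k-packing∣≤∣dominating∣ : ∀ {k S P} → Dominating k S → IsPacking (2 * k) G P → ∣ P ∣ ≤ ∣ S ∣
  ∣2k-packing∣≤∣dominating∣ {k} {S} {P} dom pack =
    injection⇒∣p∣≤∣q∣ (λ v → proj₁ (dom v)) (λ {v} _ → proj₁ (proj₂ (dom v))) injective
    where
    within-2k : ∀ {u v s} → DistLE G u s k → DistLE G v s k → DistLE G u v (2 * k)
    within-2k {u} {v} du dv =
      subst (DistLE G u v) (cong (k +_) (≡-sym (+-identityʳ k))) (DistLE-trans du (DistLE-sym dv))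

    injective : ∀ {u v} → u ∈ P → v ∈ P → proj₁ (dom u) ≡ proj₁ (dom v) → u ≡ v
    injective {u} {v} u∈P v∈P same with u ≟ v
    ... | yes u≡v = u≡v
    ... | no u≢v = ⊥-elim (pack u∈P v∈P u≢v (within-2k (proj₂ (proj₂ (dom u)))
            (subst (λ s → DistLE G v s k) (≡-sym same) (proj₂ (proj₂ (dom v))))))

corollary4 : ∀ {n} (k : ℕ) (G : Graph n) → 1 ≤ k →
    (∃ λ m → PackingNumber k G m × PackingNumber (2 * k) G m) →
    Equipackable k G
corollary4 k G _ (m , (_ , ρₖ-bound) , ((P , P-pack , ∣P∣≡m) , _)) S T S-max T-max =
  trans (∣maximal∣≡m S S-max) (≡-sym (∣maximal∣≡m T T-max))
  where
  ∣maximal∣≡m : ∀ S → IsMaximalPacking k G S → ∣ S ∣ ≡ m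
  ∣maximal∣≡m S S-max = ≤-antisym (ρₖ-bound S (proj₁ S-max))
    (subst (_≤ ∣ S ∣) ∣P∣≡m (∣2k-packing∣≤∣dominating∣ G (maximal-packing⇒dominating G S-max) P-pack))
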